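{- Let $f$ be the transition function of an oblivious agent, i.e., for every $d\ge 1$, $f(\cdot,d)$ is a function from $\{1,\dots,d\}$ to $\{1,\dots,d\}$. Suppose the agent explores all stars: for every $d\ge1$, every port numbering of the star $K_{1,d}$, and every starting node (and any initial exit port if started at the center), the agent eventually visits every node of the star. Then $f$ is equivalent to the Right-Hand-on-the-Wall algorithm, i.e., for every $d\ge 1$ there exists a permutation $\sigma$ of $\{1,\dots,d\}$ such that $f(\cdot,d)=\sigma\circ r_d\circ\sigma^{ -1}$, where $r_d(i)=(i\bmod d)+1$.
   Context: A port numbering of a graph assigns to each node $v$ of degree $d_v$ a bijection from the edges incident to $v$ onto $\{1,\dots,d_v\}$. An oblivious agent (a one-state automaton) that enters a node $v$ of degree $d_v$ through port $i$ exits $v$ through port $f(i,d_v)$. The Right-Hand-on-the-Wall algorithm is the oblivious agent with transition $i\mapsto (i\bmod d)+1$ at degree-$d$ nodes. -}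

module Defs where

open import Data.Nat using (ℕ; zero; suc)
open import Data.Nat.DivMod using (_%_; m%n<n)
open import Data.Fin using (Fin; zero; suc; toℕ; fromℕ<)
open import Data.Fin.Permutation using (Permutation; _⟨$⟩ʳ_; _⟨$⟩ˡ_)
open import Data.Product using (∃)
open import Relation.Binary.PropositionalEquality using (_≡_)

-- Ports are 0-indexed: port k ∈ Fin d stands for the paper's port k+1.

-- Transition function of an oblivious agent: for each degree d,
-- f d : Fin d → Fin d  (entry port ↦ exit port).
Agent : Set
Agent = (d : ℕ) → Fin d → Fin d

-- Right-Hand-on-the-Wall rotation r_d(i) = (i mod d) + 1, 0-indexed:
-- port k ↦ (k + 1) mod d.
rot : (n : ℕ) → Fin (suc n) → Fin (suc n)
rot n i = fromℕ< (m%n<n (suc (toℕ i)) (suc n))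

-- The star K_{1,d}: a center and leaves indexed by Fin d
-- (leaf j is joined to the center by edge j).
data StarNode (d : ℕ) : Set where
  center : StarNode d
  leaf   : Fin d → StarNode d

-- A port numbering of K_{1,d}: at the center, a bijection π from the
-- incident edges (indexed by leaves) onto the ports; π ⟨$⟩ʳ j is the center
-- port of edge j.  Each leaf has degree 1, so its numbering is forced (port 0).
PortNumbering : ℕ → Set
PortNumbering d = Permutation d d

-- Configuration of the agent: the node it is at and the port through which
-- it is about to exit.
data Config (d : ℕ) : Set where
  atCenter : Fin d → Config d
  atLeaf   : Fin d → Fin 1 → Config d

node : ∀ {d} → Config d → StarNode d
node (atCenter _) = center
node (atLeaf j _) = leaf j

step : (f : Agent) (d : ℕ) → PortNumbering d → Config d → Config d
step f d π (atCenter p) = atLeaf (π ⟨$⟩ˡ p) (f 1 zero)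
step f d π (atLeaf j _) = atCenter (f d (π ⟨$⟩ʳ j))

run : (f : Agent) (d : ℕ) → PortNumbering d → Config d → ℕ → Config d
run f d π c zero    = c
run f d π c (suc n) = step f d π (run f d π c n)

ExploresFrom : (f : Agent) (d : ℕ) → PortNumbering d → Config d → Set
ExploresFrom f d π c = (u : StarNode d) → ∃ λ n → node (run f d π c n) ≡ u

-- The agent explores all stars: every d ≥ 1, every port numbering, every
-- starting node (at the center with any initial exit port; at a leaf the
-- only exit port is 0).  All configurations are exactly these starts.
ExploresAllStars : Agent → Set
ExploresAllStars f = (n : ℕ) (π : PortNumbering (suc n)) (c : Config (suc n)) →
  ExploresFrom f (suc n) π c

EquivRHW : Agent → Set
EquivRHW f = (n : ℕ) → ∃ λ (σ : Permutation (suc n) (suc n)) →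
  (i : Fin (suc n)) → f (suc n) i ≡ σ ⟨$⟩ʳ (rot n (σ ⟨$⟩ˡ i))

module Submission where

open import Defs
open import Data.Nat using (ℕ; zero; suc; _+_; _*_; _∸_; _≤_; _<_; _≤?_; NonZero; >-nonZero; z<s)
open import Data.Nat.Properties
  using (≤-trans; ≤-reflexive; ≤-antisym; <⇒≤; ≰⇒>; <⇒≱; <-cmp; m≤m+n; m∸n+n≡m; m<n⇒0<n∸m; +-monoʳ-<)
open import Data.Nat.DivMod using (_%_; _/_; m%n<n; m≡m%n+[m/n]*n)
open import Data.Nat.GeneralisedArithmetic using (fold; fold-+)
open import Data.Nat.Induction using (<-wellFounded)
open import Induction.WellFounded using (Acc; acc)
open import Data.Fin using (Fin; zero; toℕ; fromℕ<)
open import Data.Fin.Properties using (toℕ-fromℕ<; toℕ-injective; toℕ<n; pigeonhole; injective⇒≤)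
open import Data.Fin.Permutation using (Permutation; _⟨$⟩ʳ_; _⟨$⟩ˡ_; permutation)
import Data.Fin.Permutation as Perm
open import Data.Product using (∃; _,_; proj₁; proj₂; _×_)
open import Data.Empty using (⊥; ⊥-elim)
open import Relation.Nullary using (yes; no)
open import Relation.Binary using (tri<; tri≈; tri>)
open import Relation.Binary.PropositionalEquality using (_≡_; refl; sym; trans; cong; subst; module ≡-Reasoning)

-- Put the star K_{1,d} under the identity port numbering.  An
-- agent leaving the center by port p walks to leaf p, comes back in through
-- port p and leaves by port g p, where g = f d.  Hence the leaves it visits
-- are exactly the orbit p, g p, g² p, …, and exploring the star from every
-- start means that g is *transitive*: every port is reached from every port
-- by iterating g.  It remains to show that a transitive self-map g of
-- Fin d is a single d-cycle, i.e. conjugate to the rotation k ↦ k+1 mod d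
-- via σ k = g^k 0.
--
-- On Fin d, when the orbit of x covers everything, every
-- positive period is ≥ d (an orbit of period P has at most P points) and,
-- by pigeonhole descent, some positive period is ≤ d; so d is a period and
-- the orbit is injective on [0, d).  This makes σ a permutation with
-- σ ∘ rot = g ∘ σ.  Finally the star argument above supplies transitivity.

module Periods {a} {A : Set a} (g : A → A) (x : A) where

  orbit : ℕ → A
  orbit k = fold x g k

  Period : ℕ → Set a
  Period P = orbit P ≡ x

  orbit-+ : ∀ m n → orbit (m + n) ≡ fold (orbit n) g m
  orbit-+ m n = fold-+ x g m

  orbit-suc : ∀ k → orbit (suc k) ≡ fold (g x) g k
  orbit-suc zero    = refl
  orbit-suc (suc k) = cong g (orbit-suc k)

  period-* : ∀ {P} → Period P → ∀ q → Period (q * P)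
  period-* pe zero    = refl
  period-* {P} pe (suc q) = begin
    orbit (P + q * P)            ≡⟨ orbit-+ P (q * P) ⟩
    fold (orbit (q * P)) g P     ≡⟨ cong (λ y → fold y g P) (period-* pe q) ⟩
    orbit P                      ≡⟨ pe ⟩
    x                            ∎
    where open ≡-Reasoning

  orbit-mod : ∀ P .{{_ : NonZero P}} → Period P → ∀ m → orbit m ≡ orbit (m % P)
  orbit-mod P pe m = begin
    orbit m                              ≡⟨ cong orbit (m≡m%n+[m/n]*n m P) ⟩
    orbit (m % P + m / P * P)            ≡⟨ orbit-+ (m % P) (m / P * P) ⟩
    fold (orbit (m / P * P)) g (m % P)   ≡⟨ cong (λ y → fold y g (m % P)) (period-* pe (m / P)) ⟩
    orbit (m % P)                        ∎
    where open ≡-Reasoning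

  -- If the orbit takes the same value at times i and j ≤ P of a period P,
  -- then skipping the loop from i to j gives the period (P ∸ j) + i.
  shorten : ∀ {P i j} → j ≤ P → Period P → orbit i ≡ orbit j → Period ((P ∸ j) + i)
  shorten {P} {i} {j} j≤P pe eq = begin
    orbit ((P ∸ j) + i)        ≡⟨ orbit-+ (P ∸ j) i ⟩
    fold (orbit i) g (P ∸ j)   ≡⟨ cong (λ y → fold y g (P ∸ j)) eq ⟩
    fold (orbit j) g (P ∸ j)   ≡⟨ sym (orbit-+ (P ∸ j) j) ⟩
    orbit ((P ∸ j) + j)        ≡⟨ cong orbit (m∸n+n≡m j≤P) ⟩
    orbit P                    ≡⟨ pe ⟩
    x                          ∎
    where open ≡-Reasoning

shorter : ∀ {P i j} → i < j → j < P → 0 < (P ∸ j) + i × (P ∸ j) + i < P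
shorter {P} {i} {j} i<j j<P =
    ≤-trans (m<n⇒0<n∸m j<P) (m≤m+n (P ∸ j) i)
  , ≤-trans (+-monoʳ-< (P ∸ j) i<j) (≤-reflexive (m∸n+n≡m (<⇒≤ j<P)))

-- A map on Fin d whose orbit from x covers Fin d is a d-cycle through x.
module CoveringOrbit {d} (g : Fin d → Fin d) (x : Fin d)
                     (covers : ∀ q → ∃ λ k → Periods.orbit g x k ≡ q) where
  open Periods g x

  index : ∀ P .{{_ : NonZero P}} → Fin d → Fin P
  index P q = fromℕ< (m%n<n (proj₁ (covers q)) P)

  orbit-index : ∀ P .{{_ : NonZero P}} → Period P → ∀ q → orbit (toℕ (index P q)) ≡ q
  orbit-index P pe q = begin
    orbit (toℕ (index P q))   ≡⟨ cong orbit (toℕ-fromℕ< (m%n<n k P)) ⟩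
    orbit (k % P)             ≡⟨ sym (orbit-mod P pe k) ⟩
    orbit k                   ≡⟨ proj₂ (covers q) ⟩
    q                         ∎
    where
    open ≡-Reasoning
    k : ℕ
    k = proj₁ (covers q)

  -- An orbit of period P has at most P points, so every positive period is ≥ d.
  period≥d : ∀ {P} → 0 < P → Period P → d ≤ P
  period≥d {P} 0<P pe = injective⇒≤ {f = index P} index-injective
    where
    instance
      P-nonZero : NonZero P
      P-nonZero = >-nonZero 0<P
    index-injective : ∀ {q r} → index P q ≡ index P r → q ≡ r
    index-injective {q} {r} e =
      trans (sym (orbit-index P pe q)) (trans (cong (λ k → orbit (toℕ k)) e) (orbit-index P pe r))

  -- A positive period P > d has a collision among its first P orbit points
  -- (pigeonhole), which shortens it; iterating, some positive period is ≤ d.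
  descent : ∀ {P} → Acc _<_ P → 0 < P → Period P → ∃ λ Q → 0 < Q × Q ≤ d × Period Q
  descent {P} (acc smaller) 0<P pe with P ≤? d
  ... | yes P≤d = P , 0<P , P≤d , pe
  ... | no P≰d with pigeonhole (≰⇒> P≰d) (λ (k : Fin P) → orbit (toℕ k))
  ...   | i , j , i<j , eq with shorter i<j (toℕ<n j)
  ...     | 0<Q , Q<P = descent (smaller Q<P) 0<Q (shorten (<⇒≤ (toℕ<n j)) pe eq)

  period-d : ∀ {P} → 0 < P → Period P → Period d
  period-d {P} 0<P pe with descent (<-wellFounded P) 0<P pe
  ... | Q , 0<Q , Q≤d , peQ = subst Period (≤-antisym Q≤d (period≥d 0<Q peQ)) peQ

  -- With period d, the first d orbit points are distinct: a collision would
  -- give a positive period below d.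
  orbit-injective : Period d → ∀ {i j} → i < j → j < d → orbit i ≡ orbit j → ⊥
  orbit-injective pe i<j j<d eq with shorter i<j j<d
  ... | 0<Q , Q<d = <⇒≱ Q<d (period≥d 0<Q (shorten (<⇒≤ j<d) pe eq))

-- A self-map of Fin (suc n) in which every point reaches every point is
-- conjugate to the rotation, via the enumeration σ k = g^k 0 of its orbit.
transitive⇒rotation : ∀ n (g : Fin (suc n) → Fin (suc n)) →
  (∀ p q → ∃ λ k → fold p g k ≡ q) →
  ∃ λ (σ : Permutation (suc n) (suc n)) → ∀ i → g i ≡ σ ⟨$⟩ʳ (rot n (σ ⟨$⟩ˡ i))
transitive⇒rotation n g reach = σ , conjugate
  where
  d : ℕ
  d = suc n
  open Periods g zero
  open CoveringOrbit g zero (reach zero)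

  -- 0 returns to itself: it is reached from g 0 after k steps.
  period : Period d
  period with reach (g zero) zero
  ... | k , e = period-d {suc k} z<s (trans (orbit-suc k) e)

  σf : Fin d → Fin d
  σf k = orbit (toℕ k)

  σf-injective : ∀ {i j} → σf i ≡ σf j → i ≡ j
  σf-injective {i} {j} e with <-cmp (toℕ i) (toℕ j)
  ... | tri< i<j _ _ = ⊥-elim (orbit-injective period i<j (toℕ<n j) e)
  ... | tri≈ _ i≡j _ = toℕ-injective i≡j
  ... | tri> _ _ j<i = ⊥-elim (orbit-injective period j<i (toℕ<n i) (sym e))

  σ : Permutation d d
  σ = permutation σf (index d) (orbit-index d period)
                  (λ k → σf-injective (orbit-index d period (σf k)))

  σ-rot : ∀ k → σf (rot n k) ≡ g (σf k)
  σ-rot k = trans (cong orbit (toℕ-fromℕ< (m%n<n (suc (toℕ k)) d)))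
                  (sym (orbit-mod d period (suc (toℕ k))))

  conjugate : ∀ i → g i ≡ σ ⟨$⟩ʳ (rot n (σ ⟨$⟩ˡ i))
  conjugate i = sym (trans (σ-rot (index d i)) (cong g (orbit-index d period i)))

-- Under the identity port numbering, edge j of the star has port j at the
-- center.
centerPort : ∀ {d} → Config d → Fin d
centerPort (atCenter p) = p
centerPort (atLeaf j _) = j

leaf-centerPort : ∀ {d} {q : Fin d} (c : Config d) → node c ≡ leaf q → centerPort c ≡ q
leaf-centerPort (atLeaf j _) refl = refl

-- Started at the center with exit port p under the identity numbering, the
-- agent only ever uses ports of the orbit of p under f d: a round trip to a
-- leaf enters the center through the port it left by, then applies f d.
ports-in-orbit : ∀ (f : Agent) d p m →
  ∃ λ k → fold p (f d) k ≡ centerPort (run f d Perm.id (atCenter p) m)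
ports-in-orbit f d p zero = 0 , refl
ports-in-orbit f d p (suc m) with run f d Perm.id (atCenter p) m | ports-in-orbit f d p m
... | atCenter x | k , e = k , e
... | atLeaf j _ | k , e = suc k , cong (f d) e

-- An agent exploring all stars has transitive transition maps: since it
-- reaches leaf q from port p, the port q lies in the orbit of p.
explores⇒transitive : ∀ f → ExploresAllStars f →
  ∀ n p q → ∃ λ k → fold p (f (suc n)) k ≡ q
explores⇒transitive f explores n p q with explores n Perm.id (atCenter p) (leaf q)
... | m , at-q with ports-in-orbit f (suc n) p m
...   | k , e = k , trans e (leaf-centerPort _ at-q)

lemma4 : (f : Agent) → ExploresAllStars f → EquivRHW f
lemma4 f explores n = transitive⇒rotation n (f (suc n)) (explores⇒transitive f explores n)
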